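{- Let $\mathbf A$ be a finite idempotent algebra. If $\mathbf A$ has a difference term operation, then so does every quotient of $\mathbf A$.
   Context: An algebra is idempotent if each basic operation satisfies $f(x,\dots,x)=x$. A difference term operation for an algebra $\mathbf C$ is a ternary term operation $d$ of $\mathbf C$ such that for all $a,b\in C$: $d(a,a,b)=b$ and $(d(a,b,b),a)\in[\theta,\theta]$ for every congruence $\theta$ of $\mathbf C$ containing $(a,b)$, where $[\cdot,\cdot]$ is the term-condition commutator. -}

module Defs where

open import Level using (0ℓ)
open import Data.Nat using (ℕ)
open import Data.Fin using (Fin)
open import Data.Sum using (_⊎_; [_,_])
open import Data.Product using (Σ; ∃; _×_)
open import Relation.Binary using (Rel; IsEquivalence; Setoid)
open import Relation.Binary.PropositionalEquality as ≡ using (_≡_)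
open import Function.Bundles using (Inverse)

record Signature : Set₁ where
  field
    Op    : Set
    arity : Op → ℕ

-- An algebra of the given signature, with carrier a setoid
-- (standard constructive rendering; quotients are obtained by
-- changing the equality relation).
record Algebra (σ : Signature) : Set₁ where
  open Signature σ
  field
    Carrier  : Set
    _≈_      : Rel Carrier 0ℓ
    isEquiv  : IsEquivalence _≈_
    op       : (f : Op) → (Fin (arity f) → Carrier) → Carrier
    op-cong  : (f : Op) {xs ys : Fin (arity f) → Carrier} →
               (∀ i → xs i ≈ ys i) → op f xs ≈ op f ys

  setoid : Setoid 0ℓ 0ℓ
  setoid = record { Carrier = Carrier ; _≈_ = _≈_ ; isEquivalence = isEquiv }

module _ {σ : Signature} where
  open Signature σ

  data Term (V : Set) : Set where
    var : V → Term V
    app : (f : Op) → (Fin (arity f) → Term V) → Term V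

  eval : (A : Algebra σ) {V : Set} → Term V → (V → Algebra.Carrier A) → Algebra.Carrier A
  eval A (var x)    ρ = ρ x
  eval A (app f ts) ρ = Algebra.op A f (λ i → eval A (ts i) ρ)

  Finite : Algebra σ → Set
  Finite A = ∃ λ n → Inverse (Algebra.setoid A) (≡.setoid (Fin n))

  Idempotent : Algebra σ → Set
  Idempotent A = ∀ f x → Algebra._≈_ A (Algebra.op A f (λ _ → x)) x

  record Congruence (A : Algebra σ) : Set₁ where
    open Algebra A
    field
      rel        : Rel Carrier 0ℓ
      isEquiv    : IsEquivalence rel
      ≈⊆rel      : ∀ {x y} → x ≈ y → rel x y
      compatible : (f : Op) {xs ys : Fin (arity f) → Carrier} →
                   (∀ i → rel (xs i) (ys i)) → rel (op f xs) (op f ys)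

  _/_ : (A : Algebra σ) → Congruence A → Algebra σ
  A / θ = record
    { Carrier = Algebra.Carrier A
    ; _≈_     = Congruence.rel θ
    ; isEquiv = Congruence.isEquiv θ
    ; op      = Algebra.op A
    ; op-cong = Congruence.compatible θ
    }

  Centralizes : (A : Algebra σ) (α β δ : Congruence A) → Set
  Centralizes A α β δ =
    (m n : ℕ) (t : Term (Fin m ⊎ Fin n))
    (a b : Fin m → Algebra.Carrier A) (c d : Fin n → Algebra.Carrier A) →
    (∀ i → Congruence.rel α (a i) (b i)) →
    (∀ j → Congruence.rel β (c j) (d j)) →
    Congruence.rel δ (eval A t [ a , c ]) (eval A t [ a , d ]) →
    Congruence.rel δ (eval A t [ b , c ]) (eval A t [ b , d ])

  -- Membership in the term-condition commutator [α, β]: the least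
  -- congruence δ with C(α, β; δ), i.e. the intersection of all such δ.
  InCommutator : (A : Algebra σ) (α β : Congruence A) →
                 Algebra.Carrier A → Algebra.Carrier A → Set₁
  InCommutator A α β x y =
    (δ : Congruence A) → Centralizes A α β δ → Congruence.rel δ x y

  IsDifferenceTerm : (C : Algebra σ) → Term (Fin 3) → Set₁
  IsDifferenceTerm C d =
    (a b : Algebra.Carrier C) →
    (Algebra._≈_ C (eval C d (args a a b)) b) ×
    ((θ : Congruence C) → Congruence.rel θ a b →
       InCommutator C θ θ (eval C d (args a b b)) a)
    where
      args : Algebra.Carrier C → Algebra.Carrier C → Algebra.Carrier C →
             Fin 3 → Algebra.Carrier C
      args x y z Fin.zero = x
      args x y z (Fin.suc Fin.zero) = y
      args x y z (Fin.suc (Fin.suc Fin.zero)) = z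

  HasDifferenceTerm : Algebra σ → Set₁
  HasDifferenceTerm C = Σ (Term (Fin 3)) (IsDifferenceTerm C)

-- A congruence ψ of A / θ is the same relation viewed as a congruence of A
-- (one containing θ), and since A / θ has the same term operations as A,
-- C(α, β; δ) in A / θ is exactly C(α, β; δ) in A.  Hence every pair in
-- [α, β] computed in A already lies in [α, β] computed in A / θ, which
-- intersects fewer congruences, and a difference term of A stays one of A / θ.
module Submission where

open import Defs
open import Data.Fin using (Fin; zero; suc)
open import Data.Sum using ([_,_])
open import Data.Product using (_,_; proj₁; proj₂)
open import Relation.Binary using (IsEquivalence)
open import Relation.Binary.PropositionalEquality using (_≡_; refl)

inCommutator-respˡ : {σ : Signature} (C : Algebra σ) (α β : Congruence C)
                     {x x′ y : Algebra.Carrier C} → Algebra._≈_ C x x′ →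
                     InCommutator C α β x y → InCommutator C α β x′ y
inCommutator-respˡ C α β x≈x′ x~y δ cent =
  IsEquivalence.trans (Congruence.isEquiv δ)
    (IsEquivalence.sym (Congruence.isEquiv δ) (Congruence.≈⊆rel δ x≈x′)) (x~y δ cent)

module _ {σ : Signature} (A : Algebra σ) (θ : Congruence A) where
  open Algebra A using (Carrier; _≈_; op-cong)
  private module ≈ = IsEquivalence (Algebra.isEquiv A)

  eval-quotient : {V : Set} (t : Term V) {ρ ρ′ : V → Carrier} →
                  (∀ v → ρ v ≡ ρ′ v) → eval (A / θ) t ρ ≈ eval A t ρ′
  eval-quotient (var v)    ρ≡ρ′ = ≈.reflexive (ρ≡ρ′ v)
  eval-quotient (app f ts) ρ≡ρ′ = op-cong f (λ i → eval-quotient (ts i) ρ≡ρ′)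

  liftCongruence : Congruence (A / θ) → Congruence A
  liftCongruence ψ = record
    { rel        = rel
    ; isEquiv    = isEquiv
    ; ≈⊆rel      = λ x≈y → ≈⊆rel (Congruence.≈⊆rel θ x≈y)
    ; compatible = compatible
    }
    where open Congruence ψ using (rel; isEquiv; ≈⊆rel; compatible)

  module _ (δ : Congruence (A / θ)) where
    open Congruence (liftCongruence δ)
    private module δ = IsEquivalence isEquiv

    rel-eval-quotient : {V : Set} (t : Term V) (ρ ρ′ : V → Carrier) →
                        rel (eval (A / θ) t ρ) (eval (A / θ) t ρ′) →
                        rel (eval A t ρ) (eval A t ρ′)
    rel-eval-quotient t ρ ρ′ r =
      δ.trans (δ.sym (≈⊆rel (eval-quotient t λ _ → refl)))
              (δ.trans r (≈⊆rel (eval-quotient t λ _ → refl)))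

    rel-eval-unquotient : {V : Set} (t : Term V) (ρ ρ′ : V → Carrier) →
                          rel (eval A t ρ) (eval A t ρ′) →
                          rel (eval (A / θ) t ρ) (eval (A / θ) t ρ′)
    rel-eval-unquotient t ρ ρ′ r =
      δ.trans (≈⊆rel (eval-quotient t λ _ → refl))
              (δ.trans r (δ.sym (≈⊆rel (eval-quotient t λ _ → refl))))

  centralizes-lift : (α β δ : Congruence (A / θ)) → Centralizes (A / θ) α β δ →
                     Centralizes A (liftCongruence α) (liftCongruence β) (liftCongruence δ)
  centralizes-lift α β δ centralizes m n t a b c d a~b c~d ac~ad =
    rel-eval-quotient δ t [ b , c ] [ b , d ]
      (centralizes m n t a b c d a~b c~d (rel-eval-unquotient δ t [ a , c ] [ a , d ] ac~ad))

  inCommutator-quotient : (α β : Congruence (A / θ)) {x y : Carrier} →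
                          InCommutator A (liftCongruence α) (liftCongruence β) x y →
                          InCommutator (A / θ) α β x y
  inCommutator-quotient α β x~y δ centralizes =
    x~y (liftCongruence δ) (centralizes-lift α β δ centralizes)

  hasDifferenceTerm-quotient : HasDifferenceTerm A → HasDifferenceTerm (A / θ)
  hasDifferenceTerm-quotient (d , isDiff) = d , λ a b →
      Congruence.≈⊆rel θ (≈.trans (eval-quotient d (same-args refl refl refl)) (proj₁ (isDiff a b)))
    , λ ψ a~b → inCommutator-respˡ (A / θ) ψ ψ
        (Congruence.≈⊆rel θ (≈.sym (eval-quotient d (same-args refl refl refl))))
        (inCommutator-quotient ψ ψ (proj₂ (isDiff a b) (liftCongruence ψ) a~b))
    where
      -- The argument vectors of IsDifferenceTerm are built by a local function
      -- of Defs at two different algebras, so they agree only pointwise.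
      same-args : {ρ ρ′ : Fin 3 → Carrier} → ρ zero ≡ ρ′ zero →
                  ρ (suc zero) ≡ ρ′ (suc zero) → ρ (suc (suc zero)) ≡ ρ′ (suc (suc zero)) →
                  ∀ v → ρ v ≡ ρ′ v
      same-args p q r zero             = p
      same-args p q r (suc zero)       = q
      same-args p q r (suc (suc zero)) = r

lemma5p4 : {σ : Signature} (A : Algebra σ) → Finite A → Idempotent A →
    HasDifferenceTerm A → (θ : Congruence A) → HasDifferenceTerm (A / θ)
lemma5p4 A _ _ hasDiff θ = hasDifferenceTerm-quotient A θ hasDiff
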